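{- Let $\Sigma$ be a finite alphabet, $w,k$ positive integers, and $D\in\mathcal{B}(\Sigma,w,k)$. For every integer $k'\ge k$ there exists $D'\in\mathcal{B}(\Sigma,w,k')$ with $L(D')=L(D)$.
   Context: Fix a padding symbol $\#\notin\Sigma$. A $(\Sigma,w)$-layer is a tuple $B=(\ell,r,T,I,F,\iota,\phi)$ with $\ell,r\subseteq\{0,\dots,w-1\}$, $T\subseteq\ell\times(\Sigma\sqcup\{\#\})\times r$, $I\subseteq\ell$, $F\subseteq r$, $\iota,\phi\in\{\mathrm{true},\mathrm{false}\}$, with $I=\emptyset$ if $\iota$ is false and $F=\emptyset$ if $\phi$ is false. A $(\Sigma,w)$-ODD of length $k$ is a sequence $B_1\cdots B_k$ of $(\Sigma,w)$-layers with $\ell(B_{i+1})=r(B_i)$ for $i<k$, $\iota(B_1)$ true and $\iota(B_i)$ false for $i\ge2$, $\phi(B_k)$ true and $\phi(B_i)$ false for $i<k$; $\mathcal{B}(\Sigma,w,k)$ is the set of these. A nonempty string $\sigma_1\cdots\sigma_{k''}$ over $\Sigma$ with $k''\le k$ is accepted by $D=B_1\cdots B_k$ if, with $\hat\sigma_i=\sigma_i$ for $i\le k''$ and $\hat\sigma_i=\#$ otherwise, there are transitions $(p_i,\hat\sigma_i,q_i)\in T(B_i)$ with $p_{i+1}=q_i$ for $i<k$, $p_1\in I(B_1)$, $q_k\in F(B_k)$. $L(D)$ is the set of strings accepted by $D$. -}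

module Defs where

open import Data.Nat using (ℕ; zero; suc; _∸_; _≤_)
open import Data.Fin using (Fin; toℕ)
open import Data.Fin.Subset using (Subset; _∈_; _⊆_; ⊥)
open import Data.Bool using (Bool; true; false)
open import Data.Maybe using (Maybe; just; nothing)
open import Data.List using (List; []; _∷_; length)
open import Data.Product using (Σ; _×_; ∃₂)
open import Relation.Binary.PropositionalEquality using (_≡_; _≢_)

-- Symbols of a layer: `just a` for a ∈ Σ, `nothing` for the padding symbol #.
record Layer (A : Set) (w : ℕ) : Set where
  field
    ℓ   : Subset w
    r   : Subset w
    T   : Fin w → Maybe A → Fin w → Bool
    I   : Subset w
    F   : Subset w
    ι   : Bool
    φ   : Bool
    T⊆  : ∀ p a q → T p a q ≡ true → (p ∈ ℓ) × (q ∈ r)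
    I⊆  : I ⊆ ℓ
    F⊆  : F ⊆ r
    I∅  : ι ≡ false → I ≡ ⊥
    F∅  : φ ≡ false → F ≡ ⊥

open Layer public

-- A (Σ,w)-ODD of length k: layers B : Fin k → Layer (B i is the layer B_{i+1}).
record ODD (A : Set) (w k : ℕ) : Set where
  field
    B       : Fin k → Layer A w
    chain   : ∀ (i j : Fin k) → toℕ j ≡ suc (toℕ i) → ℓ (B j) ≡ r (B i)
    ι-first : ∀ (i : Fin k) → toℕ i ≡ 0 → ι (B i) ≡ true
    ι-rest  : ∀ (i : Fin k) → toℕ i ≢ 0 → ι (B i) ≡ false
    φ-last  : ∀ (i : Fin k) → toℕ i ≡ k ∸ 1 → φ (B i) ≡ true
    φ-rest  : ∀ (i : Fin k) → toℕ i ≢ k ∸ 1 → φ (B i) ≡ false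

open ODD public

hat : {A : Set} → List A → ℕ → Maybe A
hat []       _       = nothing
hat (x ∷ xs) zero    = just x
hat (x ∷ xs) (suc i) = hat xs i

Accepts : {A : Set} {w k : ℕ} → ODD A w k → List A → Set
Accepts {A} {w} {k} D σ =
  (σ ≢ []) × (length σ ≤ k) ×
  ∃₂ λ (p q : Fin k → Fin w) →
    (∀ i → T (B D i) (p i) (hat σ (toℕ i)) (q i) ≡ true) ×
    (∀ i j → toℕ j ≡ suc (toℕ i) → p j ≡ q i) ×
    (∀ i → toℕ i ≡ 0 → p i ∈ I (B D i)) ×
    (∀ i → toℕ i ≡ k ∸ 1 → q i ∈ F (B D i))

SameLanguage : {A : Set} {w k k' : ℕ} → ODD A w k → ODD A w k' → Set
SameLanguage {A} D D' = ∀ (σ : List A) → (Accepts D σ → Accepts D' σ) × (Accepts D' σ → Accepts D σ)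

-- Appending one layer preserves the language: the new layer reads only the
-- padding symbol # and loops on the final states of the old last layer,
-- which become its final states while the old last layer loses them.
-- A string accepted by the longer ODD has # at the new position, hence is
-- no longer than the old length, and the loop contributes nothing else.
-- Iterating reaches every k' ≥ k.
module Submission where

open import Defs
open import Data.Nat using (ℕ; _≤_; _>_)
open import Data.Fin using (Fin)
open import Data.Product using (Σ)

open import Data.Bool using (Bool; true; false)
open import Data.Empty using (⊥-elim)
open import Data.Fin using (toℕ; inject₁; fromℕ; _≟_)
open import Data.Fin.Properties
  using (toℕ-injective; toℕ-inject₁; toℕ-inject₁-≢; toℕ-fromℕ; toℕ<n)
open import Data.Fin.Relation.Unary.Top using (view; ‵fromℕ; ‵inject₁; view-fromℕ; view-inject₁)
open import Data.Fin.Subset using (Subset; _∈_; _⊆_) renaming (⊥ to ∅)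
open import Data.Fin.Subset.Properties using (⊥⊆)
open import Data.List using (List; []; _∷_; length)
open import Data.Maybe using (Maybe; just; nothing)
open import Data.Nat using (zero; suc; z≤n; s≤s; _≤′_; ≤′-refl; ≤′-step)
open import Data.Nat.Properties using (suc-injective; <⇒≢; ≤⇒≤′; m≤n⇒m≤1+n)
open import Data.Product using (_,_; _×_; proj₁; proj₂)
open import Data.Vec using (lookup)
open import Data.Vec.Properties using ([]=⇒lookup; lookup⇒[]=)
open import Function using (_∘_)
open import Relation.Nullary using (yes; no)
open import Relation.Binary.PropositionalEquality

private
  variable
    A : Set
    w k m n : ℕ

-- Proofs below match on `view i`, which also reduces every `snoc _ _ i` in the goal.
snoc : {X : Set} → (Fin n → X) → X → Fin (suc n) → X
snoc f x i with view i
... | ‵fromℕ     = x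
... | ‵inject₁ j = f j

snoc-inject₁ : {X : Set} (f : Fin n → X) (x : X) (j : Fin n) → snoc f x (inject₁ j) ≡ f j
snoc-inject₁ f x j rewrite view-inject₁ j = refl

snoc-fromℕ : {X : Set} (f : Fin n → X) (x : X) → snoc f x (fromℕ n) ≡ x
snoc-fromℕ {n = n} f x rewrite view-fromℕ n = refl

toℕ≡n⇒≡fromℕ : (i : Fin (suc n)) → toℕ i ≡ n → i ≡ fromℕ n
toℕ≡n⇒≡fromℕ {n} i eq = toℕ-injective (trans eq (sym (toℕ-fromℕ n)))

inject₁-adjacent⇒adjacent : {i j : Fin n} →
  toℕ (inject₁ j) ≡ suc (toℕ (inject₁ i)) → toℕ j ≡ suc (toℕ i)
inject₁-adjacent⇒adjacent {i = i} {j} eq rewrite toℕ-inject₁ i | toℕ-inject₁ j = eq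

adjacent⇒inject₁-adjacent : {i j : Fin n} →
  toℕ j ≡ suc (toℕ i) → toℕ (inject₁ j) ≡ suc (toℕ (inject₁ i))
adjacent⇒inject₁-adjacent {i = i} {j} eq rewrite toℕ-inject₁ i | toℕ-inject₁ j = eq

adjacent-fromℕ⇒≡fromℕ : (i : Fin (suc n)) →
  toℕ (fromℕ (suc n)) ≡ suc (toℕ (inject₁ i)) → i ≡ fromℕ n
adjacent-fromℕ⇒≡fromℕ {n} i eq = toℕ≡n⇒≡fromℕ i (begin
  toℕ i             ≡⟨ toℕ-inject₁ i ⟨
  toℕ (inject₁ i)   ≡⟨ suc-injective (trans (sym eq) (toℕ-fromℕ (suc n))) ⟩
  n                 ∎)
  where open ≡-Reasoning

fromℕ-adjacent : toℕ (fromℕ (suc n)) ≡ suc (toℕ (inject₁ (fromℕ n)))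
fromℕ-adjacent {n} = trans (toℕ-fromℕ (suc n)) (cong suc (sym (trans (toℕ-inject₁ (fromℕ n)) (toℕ-fromℕ n))))

fromℕ-has-no-successor : (j : Fin (suc n)) → toℕ j ≢ suc (toℕ (fromℕ n))
fromℕ-has-no-successor {n} j eq = <⇒≢ (toℕ<n j) (trans eq (cong suc (toℕ-fromℕ n)))

length≤⇒hat≡nothing : (σ : List A) → length σ ≤ n → hat σ n ≡ nothing
length≤⇒hat≡nothing []      _         = refl
length≤⇒hat≡nothing (_ ∷ σ) (s≤s len) = length≤⇒hat≡nothing σ len

hat≡nothing⇒length≤ : (σ : List A) (n : ℕ) → hat σ n ≡ nothing → length σ ≤ n
hat≡nothing⇒length≤ []      _       _  = z≤n
hat≡nothing⇒length≤ (_ ∷ σ) zero    ()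
hat≡nothing⇒length≤ (_ ∷ σ) (suc n) eq = s≤s (hat≡nothing⇒length≤ σ n eq)

unfinal : Layer A w → Layer A w
unfinal L = record L { F = ∅ ; φ = false ; F⊆ = ⊥⊆ ; F∅ = λ _ → refl }

padStep : Subset w → Fin w → Maybe A → Fin w → Bool
padStep S p (just _) q = false
padStep S p nothing  q with p ≟ q
... | yes _ = lookup S p
... | no  _ = false

padStep-sound : (S : Subset w) (p : Fin w) (a : Maybe A) (q : Fin w) →
  padStep S p a q ≡ true → a ≡ nothing × p ≡ q × p ∈ S
padStep-sound S p nothing q step with p ≟ q
... | yes p≡q = refl , p≡q , lookup⇒[]= p S step

padStep-loop : (S : Subset w) (p : Fin w) → p ∈ S → padStep {A = A} S p nothing p ≡ true
padStep-loop S p p∈S with p ≟ p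
... | yes _  = []=⇒lookup p∈S
... | no p≢p = ⊥-elim (p≢p refl)

padLayer : (R S : Subset w) → S ⊆ R → Layer A w
padLayer R S S⊆R = record
  { ℓ = R ; r = R ; T = padStep S ; I = ∅ ; F = S ; ι = false ; φ = true
  ; T⊆ = stays-in-R ; I⊆ = ⊥⊆ ; F⊆ = S⊆R ; I∅ = λ _ → refl ; F∅ = λ () }
  where
  stays-in-R : ∀ p a q → padStep S p a q ≡ true → p ∈ R × q ∈ R
  stays-in-R p a q step with padStep-sound S p a q step
  ... | _ , refl , p∈S = S⊆R p∈S , S⊆R p∈S

module Append (D : ODD A w (suc m)) where

  last : Fin (suc m)
  last = fromℕ m

  pad : Layer A w
  pad = padLayer (r (B D last)) (F (B D last)) (F⊆ (B D last))

  layers : Fin (suc (suc m)) → Layer A w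
  layers = snoc (unfinal ∘ B D) pad

  layers-chain : ∀ i j → toℕ j ≡ suc (toℕ i) → ℓ (layers j) ≡ r (layers i)
  layers-chain i j adj with view i | view j
  ... | ‵fromℕ     | _          = ⊥-elim (fromℕ-has-no-successor j adj)
  ... | ‵inject₁ i | ‵inject₁ j = chain D i j (inject₁-adjacent⇒adjacent adj)
  ... | ‵inject₁ i | ‵fromℕ     = cong (r ∘ B D) (sym (adjacent-fromℕ⇒≡fromℕ i adj))

  layers-ι-first : ∀ i → toℕ i ≡ 0 → ι (layers i) ≡ true
  layers-ι-first i i≡0 with view i
  ... | ‵inject₁ i = ι-first D i (trans (sym (toℕ-inject₁ i)) i≡0)
  ... | ‵fromℕ with () ← trans (sym (toℕ-fromℕ (suc m))) i≡0

  layers-ι-rest : ∀ i → toℕ i ≢ 0 → ι (layers i) ≡ false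
  layers-ι-rest i i≢0 with view i
  ... | ‵inject₁ i = ι-rest D i (i≢0 ∘ trans (toℕ-inject₁ i))
  ... | ‵fromℕ     = refl

  layers-φ-last : ∀ i → toℕ i ≡ suc m → φ (layers i) ≡ true
  layers-φ-last i i≡last with view i
  ... | ‵inject₁ i = ⊥-elim (toℕ-inject₁-≢ i (sym i≡last))
  ... | ‵fromℕ     = refl

  layers-φ-rest : ∀ i → toℕ i ≢ suc m → φ (layers i) ≡ false
  layers-φ-rest i i≢last with view i
  ... | ‵inject₁ i = refl
  ... | ‵fromℕ     = ⊥-elim (i≢last (toℕ-fromℕ (suc m)))

  append : ODD A w (suc (suc m))
  append = record
    { B = layers ; chain = layers-chain
    ; ι-first = layers-ι-first ; ι-rest = layers-ι-rest
    ; φ-last = layers-φ-last ; φ-rest = layers-φ-rest }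

  accepts-append : (σ : List A) → Accepts D σ → Accepts append σ
  accepts-append σ (σ≢[] , len , p , q , step , link , start , end) =
    σ≢[] , m≤n⇒m≤1+n len , snoc p (q last) , snoc q (q last) , step′ , link′ , start′ , end′
    where
    q-last∈F : q last ∈ F (B D last)
    q-last∈F = end last (toℕ-fromℕ m)

    step′ : ∀ i → T (layers i) (snoc p (q last) i) (hat σ (toℕ i)) (snoc q (q last) i) ≡ true
    step′ i with view i
    ... | ‵inject₁ i rewrite toℕ-inject₁ i = step i
    ... | ‵fromℕ rewrite toℕ-fromℕ (suc m) | length≤⇒hat≡nothing σ len =
      padStep-loop {A = A} (F (B D last)) (q last) q-last∈F

    link′ : ∀ i j → toℕ j ≡ suc (toℕ i) → snoc p (q last) j ≡ snoc q (q last) i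
    link′ i j adj with view i | view j
    ... | ‵fromℕ     | _          = ⊥-elim (fromℕ-has-no-successor j adj)
    ... | ‵inject₁ i | ‵inject₁ j = link i j (inject₁-adjacent⇒adjacent adj)
    ... | ‵inject₁ i | ‵fromℕ     = cong q (sym (adjacent-fromℕ⇒≡fromℕ i adj))

    start′ : ∀ i → toℕ i ≡ 0 → snoc p (q last) i ∈ I (layers i)
    start′ i i≡0 with view i
    ... | ‵inject₁ i = start i (trans (sym (toℕ-inject₁ i)) i≡0)
    ... | ‵fromℕ with () ← trans (sym (toℕ-fromℕ (suc m))) i≡0

    end′ : ∀ i → toℕ i ≡ suc m → snoc q (q last) i ∈ F (layers i)
    end′ i i≡last with view i
    ... | ‵inject₁ i = ⊥-elim (toℕ-inject₁-≢ i (sym i≡last))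
    ... | ‵fromℕ     = q-last∈F

  accepts-unappend : (σ : List A) → Accepts append σ → Accepts D σ
  accepts-unappend σ (σ≢[] , _ , p , q , step , link , start , end) =
    σ≢[] , len , p ∘ inject₁ , q ∘ inject₁ , step′ , link′ , start′ , end′
    where
    top : Fin (suc (suc m))
    top = fromℕ (suc m)

    pad-step : hat σ (toℕ top) ≡ nothing × p top ≡ q top × p top ∈ F (B D last)
    pad-step = padStep-sound (F (B D last)) (p top) (hat σ (toℕ top)) (q top)
      (subst (λ L → T L (p top) (hat σ (toℕ top)) (q top) ≡ true)
             (snoc-fromℕ (unfinal ∘ B D) pad) (step top))

    reads-# : hat σ (suc m) ≡ nothing
    reads-# = subst (λ i → hat σ i ≡ nothing) (toℕ-fromℕ (suc m)) (proj₁ pad-step)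

    p-top∈F : p top ∈ F (B D last)
    p-top∈F = proj₂ (proj₂ pad-step)

    len : length σ ≤ suc m
    len = hat≡nothing⇒length≤ σ (suc m) reads-#

    step′ : ∀ i → T (B D i) (p (inject₁ i)) (hat σ (toℕ i)) (q (inject₁ i)) ≡ true
    step′ i = subst₂ (λ L n → T L (p (inject₁ i)) (hat σ n) (q (inject₁ i)) ≡ true)
                     (snoc-inject₁ (unfinal ∘ B D) pad i) (toℕ-inject₁ i) (step (inject₁ i))

    link′ : ∀ i j → toℕ j ≡ suc (toℕ i) → p (inject₁ j) ≡ q (inject₁ i)
    link′ i j adj = link (inject₁ i) (inject₁ j) (adjacent⇒inject₁-adjacent adj)

    start′ : ∀ i → toℕ i ≡ 0 → p (inject₁ i) ∈ I (B D i)
    start′ i i≡0 = subst (λ L → p (inject₁ i) ∈ I L) (snoc-inject₁ (unfinal ∘ B D) pad i)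
                         (start (inject₁ i) (trans (toℕ-inject₁ i) i≡0))

    end′ : ∀ i → toℕ i ≡ m → q (inject₁ i) ∈ F (B D i)
    end′ i i≡m rewrite toℕ≡n⇒≡fromℕ i i≡m =
      subst (_∈ F (B D last)) (link (inject₁ last) top fromℕ-adjacent) p-top∈F

  append-sameLanguage : SameLanguage append D
  append-sameLanguage σ = accepts-unappend σ , accepts-append σ

open Append using (append; append-sameLanguage)

SameLanguage-refl : (D : ODD A w k) → SameLanguage D D
SameLanguage-refl D σ = (λ acc → acc) , (λ acc → acc)

SameLanguage-trans : {D₁ : ODD A w k} {D₂ : ODD A w m} {D₃ : ODD A w n} →
  SameLanguage D₁ D₂ → SameLanguage D₂ D₃ → SameLanguage D₁ D₃
SameLanguage-trans D₁≈D₂ D₂≈D₃ σ with D₁≈D₂ σ | D₂≈D₃ σ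
... | to₁ , from₁ | to₂ , from₂ = to₂ ∘ to₁ , from₁ ∘ from₂

padTo : m ≤′ n → (D : ODD A w (suc m)) → Σ (ODD A w (suc n)) (λ D′ → SameLanguage D′ D)
padTo ≤′-refl           D = D , SameLanguage-refl D
padTo (≤′-step m≤′n) D with padTo m≤′n D
... | D′ , D′≈D = append D′ , SameLanguage-trans {D₁ = append D′} {D₂ = D′} {D₃ = D} (append-sameLanguage D′) D′≈D

proposition1 : (s w k : ℕ) → w > 0 → k > 0 → (D : ODD (Fin s) w k) →
    (k' : ℕ) → k ≤ k' → Σ (ODD (Fin s) w k') (λ D' → SameLanguage D' D)
proposition1 s w (suc m) _ _ D (suc n) (s≤s m≤n) = padTo (≤⇒≤′ m≤n) D
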